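{- Let $G$ be a fork-free graph, $I$ an independent set of $G$, $M$ a module of $G$, and $\ell:=|M\cap I|$. Let $I'$ be an independent set such that there is a TS-reconfiguration sequence from $I$ to $I'$. If $\ell\ge 2$ then $|M\cap I'|=\ell$, and if $\ell\le 1$ then $|M\cap I'|\le 1$.
   Context: A module of $G=(V,E)$ is a set $M\subseteq V$ such that every vertex of $V\setminus M$ is either adjacent to all vertices of $M$ or to none. A fork is the claw with one edge subdivided once; fork-free means no induced fork. Two independent sets $A,B$ are TS-adjacent if $A\setminus B=\{x\}$, $B\setminus A=\{y\}$ and $xy\in E$; a TS-reconfiguration sequence is a sequence of independent sets with consecutive sets TS-adjacent. -}

module Defs where

open import Data.Nat using (ℕ)
open import Data.Fin using (Fin)
open import Data.Fin.Subset using (Subset; _∈_; _∉_; _∩_; ∣_∣)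
open import Data.List using (List; []; _∷_)
open import Data.Sum using (_⊎_)
open import Data.Product using (_×_; ∃; ∃-syntax; Σ-syntax)
open import Relation.Binary.PropositionalEquality using (_≡_; _≢_)
open import Relation.Nullary using (¬_)
open import Level using (0ℓ; suc)

record Graph (n : ℕ) : Set₁ where
  field
    Adj   : Fin n → Fin n → Set
    sym   : ∀ {u v} → Adj u v → Adj v u
    irrefl : ∀ {u} → ¬ Adj u u
open Graph public

module _ {n : ℕ} (G : Graph n) where

  Independent : Subset n → Set
  Independent S = ∀ u v → u ∈ S → v ∈ S → ¬ Adj G u v

  IsModule : Subset n → Set
  IsModule M = ∀ v → v ∉ M →
    (∀ u → u ∈ M → Adj G v u) ⊎ (∀ u → u ∈ M → ¬ Adj G v u)

  -- induced fork: claw with centre c and leaves a, b, d, where the edge cd is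
  -- subdivided by e (so edges ca, cb, cd, de and no other edges among them)
  IsInducedFork : Fin n → Fin n → Fin n → Fin n → Fin n → Set
  IsInducedFork c a b d e =
    (c ≢ a × c ≢ b × c ≢ d × c ≢ e × a ≢ b × a ≢ d × a ≢ e × b ≢ d × b ≢ e × d ≢ e)
    × (Adj G c a × Adj G c b × Adj G c d × Adj G d e)
    × (¬ Adj G a b × ¬ Adj G a d × ¬ Adj G a e × ¬ Adj G b d × ¬ Adj G b e
       × ¬ Adj G c e)

  ForkFree : Set
  ForkFree = ∀ c a b d e → ¬ IsInducedFork c a b d e

  TSAdjacent : Subset n → Subset n → Set
  TSAdjacent A B =
    Independent A × Independent B ×
    ∃[ x ] ∃[ y ] (Adj G x y
      × (∀ z → (z ∈ A × z ∉ B) → z ≡ x) × (x ∈ A × x ∉ B)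
      × (∀ z → (z ∈ B × z ∉ A) → z ≡ y) × (y ∈ B × y ∉ A))

  data TSReach : Subset n → Subset n → Set where
    here : ∀ {A} → Independent A → TSReach A A
    step : ∀ {A B C} → TSAdjacent A B → TSReach B C → TSReach A C

{-# OPTIONS --safe #-}
-- A TS step replaces x by a neighbour y.  If x and y are both in M or both
-- outside it, |M ∩ I| does not change.  Otherwise the endpoint outside M is
-- adjacent to the endpoint inside M, hence to all of M, so the independent set
-- containing it misses M; the other set shares everything but that endpoint,
-- so it meets M in exactly one vertex.  Hence "equal, or both at most 1" is
-- an invariant of TS-reconfiguration.
module Submission where

open import Defs
open import Data.Nat using (ℕ; _≤_; _≥_; suc; z≤n; s≤s)
open import Data.Nat.Properties using (≤⇒≯)
open import Data.Fin using (Fin)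
open import Data.Fin.Subset using (Subset; _∩_; _─_; _-_; ∣_∣; _∈_; _∉_; _⊆_; ⊥; inside; outside)
open import Data.Fin.Subset.Properties
  using (_∈?_; p─⊥≡p; p─q⊆p; x∈p∩q⁺; x∈p∩q⁻; x∈p∧x≢y⇒x∈p-y; ⊆-antisym; Empty-unique; ∣⊥∣≡0; x∈⁅x⁆)
open import Data.Vec using (_∷_; here; there)
open import Data.Product using (_×_; _,_; proj₁; proj₂; swap)
open import Data.Sum using (_⊎_; inj₁; inj₂)
open import Data.Empty using (⊥-elim)
open import Function using (_∘_; const)
open import Relation.Nullary using (yes; no; contradiction)
open import Relation.Binary.PropositionalEquality
  using (_≡_; _≢_; refl; cong; module ≡-Reasoning)
  renaming (sym to ≡-sym; trans to ≡-trans)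

private
  variable
    n : ℕ
    x y z : Fin n
    p q A B C M : Subset n

x∈p─q⇒x∉q : x ∈ p ─ q → x ∉ q
x∈p─q⇒x∉q {p = _ ∷ _} {q = _ ∷ _} (there x∈p─q) (there x∈q) = x∈p─q⇒x∉q x∈p─q x∈q

x∈p-y⇒x≢y : x ∈ p - y → x ≢ y
x∈p-y⇒x≢y {x = x} x∈p-x refl = x∈p─q⇒x∉q x∈p-x (x∈⁅x⁆ x)

x∉p⇒p-x≡p : x ∉ p → p - x ≡ p
x∉p⇒p-x≡p {x = Fin.zero}  {p = inside ∷ p}  x∉p = contradiction here x∉p
x∉p⇒p-x≡p {x = Fin.zero}  {p = outside ∷ p} x∉p = cong (outside ∷_) (p─⊥≡p p)
x∉p⇒p-x≡p {x = Fin.suc x} {p = b ∷ p}       x∉p = cong (b ∷_) (x∉p⇒p-x≡p (x∉p ∘ there))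

x∈p⇒∣p∣≡1+∣p-x∣ : x ∈ p → ∣ p ∣ ≡ suc ∣ p - x ∣
x∈p⇒∣p∣≡1+∣p-x∣ (here {xs = p})           = cong (suc ∘ ∣_∣) (≡-sym (p─⊥≡p p))
x∈p⇒∣p∣≡1+∣p-x∣ (there {y = inside}  x∈p) = cong suc (x∈p⇒∣p∣≡1+∣p-x∣ x∈p)
x∈p⇒∣p∣≡1+∣p-x∣ (there {y = outside} x∈p) = x∈p⇒∣p∣≡1+∣p-x∣ x∈p

Exchange : Subset n → Subset n → Fin n → Fin n → Set
Exchange A B x y =
  (∀ z → (z ∈ A × z ∉ B) → z ≡ x) × (x ∈ A × x ∉ B) ×
  (∀ z → (z ∈ B × z ∉ A) → z ≡ y) × (y ∈ B × y ∉ A)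

exchange-sym : Exchange A B x y → Exchange B A y x
exchange-sym (onlyA , x∈A∖B , onlyB , y∈B∖A) = onlyB , y∈B∖A , onlyA , x∈A∖B

exchange-keeps : Exchange A B x y → z ∈ A → z ≢ x → z ∈ B
exchange-keeps {B = B} {z = z} (onlyA , _) z∈A z≢x with z ∈? B
... | yes z∈B = z∈B
... | no  z∉B = contradiction (onlyA z (z∈A , z∉B)) z≢x

exchange-∩-x⊆∩-y : Exchange A B x y → M ∩ A - x ⊆ M ∩ B - y
exchange-∩-x⊆∩-y {A = A} {x = x} {y = y} {M = M} ex@(_ , _ , _ , _ , y∉A) {z} z∈M∩A-x =
  x∈p∧x≢y⇒x∈p-y (x∈p∩q⁺ (z∈M , exchange-keeps ex z∈A z≢x)) z≢y
  where
  z∈M∩A : z ∈ M ∩ A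
  z∈M∩A = p─q⊆p _ _ z∈M∩A-x
  z∈M : z ∈ M
  z∈M = proj₁ (x∈p∩q⁻ M A z∈M∩A)
  z∈A : z ∈ A
  z∈A = proj₂ (x∈p∩q⁻ M A z∈M∩A)
  z≢x : z ≢ x
  z≢x = x∈p-y⇒x≢y z∈M∩A-x
  z≢y : z ≢ y
  z≢y refl = y∉A z∈A

exchange-∩-x≡∩-y : Exchange A B x y → M ∩ A - x ≡ M ∩ B - y
exchange-∩-x≡∩-y ex = ⊆-antisym (exchange-∩-x⊆∩-y ex) (exchange-∩-x⊆∩-y (exchange-sym ex))

exchange-inside : Exchange A B x y → x ∈ M → y ∈ M → ∣ M ∩ A ∣ ≡ ∣ M ∩ B ∣
exchange-inside {A = A} {B = B} {x = x} {y = y} {M = M} ex@(_ , (x∈A , _) , _ , (y∈B , _)) x∈M y∈M = begin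
  ∣ M ∩ A ∣           ≡⟨ x∈p⇒∣p∣≡1+∣p-x∣ (x∈p∩q⁺ (x∈M , x∈A)) ⟩
  suc ∣ M ∩ A - x ∣   ≡⟨ cong (suc ∘ ∣_∣) (exchange-∩-x≡∩-y {M = M} ex) ⟩
  suc ∣ M ∩ B - y ∣   ≡⟨ x∈p⇒∣p∣≡1+∣p-x∣ (x∈p∩q⁺ (y∈M , y∈B)) ⟨
  ∣ M ∩ B ∣           ∎
  where open ≡-Reasoning

x∉p⇒x∉p∩q : x ∉ p → x ∉ p ∩ q
x∉p⇒x∉p∩q {p = p} {q = q} x∉p = x∉p ∘ proj₁ ∘ x∈p∩q⁻ p q

exchange-outside : Exchange A B x y → x ∉ M → y ∉ M → M ∩ A ≡ M ∩ B
exchange-outside {A = A} {B = B} {x = x} {y = y} {M = M} ex x∉M y∉M = begin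
  M ∩ A       ≡⟨ x∉p⇒p-x≡p (x∉p⇒x∉p∩q x∉M) ⟨
  M ∩ A - x   ≡⟨ exchange-∩-x≡∩-y ex ⟩
  M ∩ B - y   ≡⟨ x∉p⇒p-x≡p (x∉p⇒x∉p∩q y∉M) ⟩
  M ∩ B       ∎
  where open ≡-Reasoning

SameOrAtMostOne : ℕ → ℕ → Set
SameOrAtMostOne a b = a ≡ b ⊎ (a ≤ 1 × b ≤ 1)

SameOrAtMostOne-trans : ∀ {a b c} → SameOrAtMostOne a b → SameOrAtMostOne b c → SameOrAtMostOne a c
SameOrAtMostOne-trans (inj₁ refl)      b~c              = b~c
SameOrAtMostOne-trans (inj₂ a,b≤1)     (inj₁ refl)      = inj₂ a,b≤1
SameOrAtMostOne-trans (inj₂ (a≤1 , _)) (inj₂ (_ , c≤1)) = inj₂ (a≤1 , c≤1)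

≡1×≡0⇒≤1×≤1 : ∀ {a b} → a ≡ 1 × b ≡ 0 → a ≤ 1 × b ≤ 1
≡1×≡0⇒≤1×≤1 (refl , refl) = s≤s z≤n , z≤n

module _ (G : Graph n) (M-module : IsModule G M) where

  adjacent-outsider⇒adjacent-to-all : ∀ {u v} → v ∉ M → u ∈ M → Adj G v u → ∀ w → w ∈ M → Adj G v w
  adjacent-outsider⇒adjacent-to-all {u} {v} v∉M u∈M vu with M-module v v∉M
  ... | inj₁ adjacent-to-all = adjacent-to-all
  ... | inj₂ adjacent-to-none = contradiction vu (adjacent-to-none u u∈M)

  adjacent-outsider⇒∩≡⊥ : ∀ {S u v} → Independent G S → v ∈ S → v ∉ M → u ∈ M → Adj G v u → M ∩ S ≡ ⊥
  adjacent-outsider⇒∩≡⊥ {S} S-indep v∈S v∉M u∈M vu = Empty-unique λ (w , w∈M∩S) →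
    let (w∈M , w∈S) = x∈p∩q⁻ M S w∈M∩S in
    S-indep _ w v∈S w∈S (adjacent-outsider⇒adjacent-to-all v∉M u∈M vu w w∈M)

  exchange-leaving : Exchange A B x y → Independent G B → Adj G y x → x ∈ M → y ∉ M →
                     ∣ M ∩ A ∣ ≡ 1 × ∣ M ∩ B ∣ ≡ 0
  exchange-leaving {A = A} {B = B} {x = x} {y = y} ex@(_ , (x∈A , _) , _ , (y∈B , _)) B-indep yx x∈M y∉M =
    ∣M∩A∣≡1 , ∣M∩B∣≡0
    where
    open ≡-Reasoning
    ∣M∩B∣≡0 : ∣ M ∩ B ∣ ≡ 0
    ∣M∩B∣≡0 = ≡-trans (cong ∣_∣ (adjacent-outsider⇒∩≡⊥ B-indep y∈B y∉M x∈M yx)) (∣⊥∣≡0 n)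
    ∣M∩A∣≡1 : ∣ M ∩ A ∣ ≡ 1
    ∣M∩A∣≡1 = begin
      ∣ M ∩ A ∣           ≡⟨ x∈p⇒∣p∣≡1+∣p-x∣ (x∈p∩q⁺ (x∈M , x∈A)) ⟩
      suc ∣ M ∩ A - x ∣   ≡⟨ cong (suc ∘ ∣_∣) (exchange-∩-x≡∩-y {M = M} ex) ⟩
      suc ∣ M ∩ B - y ∣   ≡⟨ cong (suc ∘ ∣_∣) (x∉p⇒p-x≡p (x∉p⇒x∉p∩q y∉M)) ⟩
      suc ∣ M ∩ B ∣       ≡⟨ cong suc ∣M∩B∣≡0 ⟩
      1                   ∎

  TSAdjacent⇒SameOrAtMostOne : TSAdjacent G A B → SameOrAtMostOne ∣ M ∩ A ∣ ∣ M ∩ B ∣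
  TSAdjacent⇒SameOrAtMostOne (A-indep , B-indep , x , y , xy , ex) with x ∈? M | y ∈? M
  ... | yes x∈M | yes y∈M = inj₁ (exchange-inside ex x∈M y∈M)
  ... | no  x∉M | no  y∉M = inj₁ (cong ∣_∣ (exchange-outside ex x∉M y∉M))
  ... | yes x∈M | no  y∉M =
    inj₂ (≡1×≡0⇒≤1×≤1 (exchange-leaving ex B-indep (Graph.sym G xy) x∈M y∉M))
  ... | no  x∉M | yes y∈M =
    inj₂ (swap (≡1×≡0⇒≤1×≤1 (exchange-leaving (exchange-sym ex) A-indep xy y∈M x∉M)))

  TSReach⇒SameOrAtMostOne : TSReach G A C → SameOrAtMostOne ∣ M ∩ A ∣ ∣ M ∩ C ∣
  TSReach⇒SameOrAtMostOne (here _)       = inj₁ refl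
  TSReach⇒SameOrAtMostOne (step A~B B⇝C) =
    SameOrAtMostOne-trans (TSAdjacent⇒SameOrAtMostOne A~B) (TSReach⇒SameOrAtMostOne B⇝C)

SameOrAtMostOne⇒cases : ∀ {a b} → SameOrAtMostOne a b → (a ≥ 2 → b ≡ a) × (a ≤ 1 → b ≤ 1)
SameOrAtMostOne⇒cases (inj₁ refl)        = const refl , λ a≤1 → a≤1
SameOrAtMostOne⇒cases (inj₂ (a≤1 , b≤1)) = (λ a≥2 → ⊥-elim (≤⇒≯ a≤1 a≥2)) , const b≤1

mainTheorem9 : ∀ {n : ℕ} (G : Graph n) → ForkFree G →
    (I M I′ : Subset n) → Independent G I → IsModule G M →
    Independent G I′ → TSReach G I I′ →
    (∣ M ∩ I ∣ ≥ 2 → ∣ M ∩ I′ ∣ ≡ ∣ M ∩ I ∣) × (∣ M ∩ I ∣ ≤ 1 → ∣ M ∩ I′ ∣ ≤ 1)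
mainTheorem9 G _ I M I′ _ M-module _ I⇝I′ =
  SameOrAtMostOne⇒cases (TSReach⇒SameOrAtMostOne G M-module I⇝I′)
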